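{- Let $V$ be a finite set of variables and $\mathcal C=\{C_1,\dots,C_m\}$ a set of betweenness constraints over $V$. Let $\phi:V\to\{0,1,2,3\}$ be a uniformly random function and $X=w(\mathcal C,\phi)$. Then $X$ can be expressed as a polynomial of degree 6 in independent random variables, each uniformly distributed on $\{ -1,1\}$.
   Context: A betweenness constraint is written $(v_i,\{v_j,v_k\})$ for distinct $v_i,v_j,v_k\in V$; a bijection $\alpha:V\to\{1,\dots,|V|\}$ satisfies it if $\alpha(v_j)<\alpha(v_i)<\alpha(v_k)$ or $\alpha(v_k)<\alpha(v_i)<\alpha(v_j)$. For $\phi:V\to\{0,1,2,3\}$ let $\ell_i(\phi)=|\phi^{ -1}(i)|$. A random $\phi$-compatible bijection $\alpha$ is obtained by assigning the values $1,\dots,\ell_0(\phi)$ uniformly at random (bijectively) to the variables with $\phi(v)=0$, and, for $j=1,2,3$, the values $\sum_{i<j}\ell_i(\phi)+1,\dots,\sum_{i\le j}\ell_i(\phi)$ uniformly at random to the variables with $\phi(v)=j$. For a constraint $C_p$, let $\nu_p(\alpha)=1$ if $\alpha$ satisfies $C_p$ and $0$ otherwise; define $w(C_p,\phi)=\mathbb E[\nu_p(\alpha)]-1/3$, the expectation over a random $\phi$-compatible bijection $\alpha$ for fixed $\phi$, and $w(\mathcal C,\phi)=\sum_{p=1}^m w(C_p,\phi)$. A uniformly random $\phi$ assigns to each variable independently a uniformly random value in $\{0,1,2,3\}$. -}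

module Defs where

open import Data.Nat as ℕ using (ℕ; zero; suc; _<ᵇ_)
open import Data.Fin using (Fin; toℕ)
open import Data.Fin.Properties using (_≟_)
open import Data.Vec using (Vec; []; _∷_; lookup)
open import Data.List using (List; []; _∷_; [_]; map; concatMap; allFin; filterᵇ; length; foldr)
open import Data.Bool.ListAction using (all; any)
open import Data.Bool using (Bool; true; false; _∧_; _∨_; not; if_then_else_)
open import Data.Product using (_×_; _,_; proj₁; proj₂)
open import Data.Integer using (+_)
open import Data.Rational using (ℚ; 0ℚ; 1ℚ; -_; _/_; _+_; _-_; _*_)
open import Relation.Nullary.Decidable using (⌊_⌋)
open import Relation.Binary.PropositionalEquality using (_≢_; _≡_)
open import Data.List.Relation.Unary.All using (All)

-- Variables V = Fin n.  A betweenness constraint (v_i , {v_j , v_k})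
-- with v_i, v_j, v_k pairwise distinct.
record Constraint (n : ℕ) : Set where
  constructor btw
  field
    vi vj vk : Fin n
    i≢j : vi ≢ vj
    i≢k : vi ≢ vk
    j≢k : vj ≢ vk
open Constraint public

allVecs : {A : Set} → List A → (k : ℕ) → List (Vec A k)
allVecs xs zero = [ [] ]
allVecs xs (suc k) = concatMap (λ x → map (x ∷_) (allVecs xs k)) xs

count : {A : Set} → (A → Bool) → List A → ℕ
count p xs = length (filterᵇ p xs)

_==F_ : {n : ℕ} → Fin n → Fin n → Bool
a ==F b = ⌊ a ≟ b ⌋

_<F_ : {n : ℕ} → Fin n → Fin n → Bool
a <F b = toℕ a <ᵇ toℕ b

_==V_ : {A : Set} {k : ℕ} → (A → A → Bool) → Vec A k → Vec A k → Bool
(eq ==V []) [] = true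
(eq ==V (x ∷ xs)) (y ∷ ys) = eq x y ∧ (eq ==V xs) ys

-- φ : V → {0,1,2,3} as a vector; α : V → {1,...,n} as a vector of
-- 0-based values (α v = toℕ (lookup α v) + 1).
Assign : ℕ → Set
Assign n = Vec (Fin 4) n

Ordering : ℕ → Set
Ordering n = Vec (Fin n) n

isBijection : {n : ℕ} → Ordering n → Bool
isBijection {n} α =
  all (λ u → all (λ v → not (lookup α u ==F lookup α v) ∨ (u ==F v)) (allFin n)) (allFin n)
  ∧ all (λ x → any (λ v → lookup α v ==F x) (allFin n)) (allFin n)

-- lo φ j = Σ_{i<j} ℓ_i(φ),  hi φ j = Σ_{i≤j} ℓ_i(φ)
lo : {n : ℕ} → Assign n → Fin 4 → ℕ
lo {n} φ j = count (λ u → lookup φ u <F j) (allFin n)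

hi : {n : ℕ} → Assign n → Fin 4 → ℕ
hi {n} φ j = count (λ u → (lookup φ u <F j) ∨ (lookup φ u ==F j)) (allFin n)

-- α is φ-compatible: a bijection assigning to each v with φ v = j a value
-- among Σ_{i<j} ℓ_i + 1, ..., Σ_{i≤j} ℓ_i  (0-based: lo ≤ α v < hi).
compatible : {n : ℕ} → Assign n → Ordering n → Bool
compatible {n} φ α = isBijection α ∧
  all (λ v → (lo φ (lookup φ v) ℕ.≤ᵇ toℕ (lookup α v))
             ∧ (toℕ (lookup α v) <ᵇ hi φ (lookup φ v))) (allFin n)

satisfies : {n : ℕ} → Ordering n → Constraint n → Bool
satisfies α c =
  ((lookup α (vj c) <F lookup α (vi c)) ∧ (lookup α (vi c) <F lookup α (vk c)))
  ∨ ((lookup α (vk c) <F lookup α (vi c)) ∧ (lookup α (vi c) <F lookup α (vj c)))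

ratio : ℕ → ℕ → ℚ
ratio s zero = 0ℚ
ratio s (suc c) = (+ s) / suc c

-- E[ν_p(α)] over a uniformly random φ-compatible bijection α
-- (the compatible bijections form a nonempty finite set and the random
-- compatible bijection is uniform on it).
expectSat : {n : ℕ} → Constraint n → Assign n → ℚ
expectSat {n} c φ =
  ratio (count (λ α → compatible φ α ∧ satisfies α c) (allVecs (allFin n) n))
        (count (λ α → compatible φ α) (allVecs (allFin n) n))

wC : {n : ℕ} → Constraint n → Assign n → ℚ
wC c φ = expectSat c φ - (+ 1 / 3)

w : {n : ℕ} → List (Constraint n) → Assign n → ℚ
w cs φ = foldr (λ c acc → wC c φ + acc) 0ℚ cs

-- Polynomials over ℚ in N variables: list of (coefficient, monomial),
-- a monomial being a list of variable indices (multiplied together).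
Poly : ℕ → Set
Poly N = List (ℚ × List (Fin N))

degree≤ : {N : ℕ} → ℕ → Poly N → Set
degree≤ d P = All (λ m → length (proj₂ m) ℕ.≤ d) P

-- a point of {-1,1}^N : true ↦ 1, false ↦ -1
sign : Bool → ℚ
sign true = 1ℚ
sign false = - 1ℚ

evalPoly : {N : ℕ} → Poly N → Vec Bool N → ℚ
evalPoly P σ = foldr (λ m acc → (proj₁ m * foldr (λ i r → sign (lookup σ i) * r) 1ℚ (proj₂ m)) + acc) 0ℚ P

-- g : {-1,1}^N → {0,1,2,3}^V pushes the uniform distribution on {-1,1}^N
-- (N independent uniform ±1 variables) to the uniform distribution on φ's:
-- every φ has exactly 2^N / 4^n preimages.
uniformPush : {N n : ℕ} → (Vec Bool N → Assign n) → Set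
uniformPush {N} {n} g = (φ : Assign n) →
  count (λ σ → (_==F_ ==V g σ) φ) (allVecs (true ∷ false ∷ []) N) ℕ.* (4 ℕ.^ n) ≡ 2 ℕ.^ N

module Submission where

-- Encode φ by 2n bits, two per variable (`assignment`): this is a bijection
-- {-1,1}^(2n) ≅ {0,1,2,3}^V, so the uniform distribution on the bits is
-- pushed to the uniform distribution on φ (`uniform`).  The heart of the
-- proof is that E[ν_p] depends only on the blocks φ(v_i), φ(v_j), φ(v_k)
-- of the three variables of C_p (`expectSat-blocks`).  If v_i is alone in
-- its block, all φ-compatible orderings agree on C_p, since blocks are
-- placed in order.  Otherwise the transposition (v_i v_j), the
-- transposition (v_i v_k) or the 3-cycle (v_i v_j v_k) preserves φ and acts
-- on the compatible orderings so that each orbit contains exactly one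
-- satisfying ordering, which gives 1/2, 1/2 or 1/3 (`expect-orbit`).
-- So w(C_p, φ) is a function of six of the bits, and every function of k
-- bits is a polynomial of degree ≤ k in them (`interpolate`); summing over
-- the constraints proves the lemma.

open import Defs
open import Data.Bool using (Bool; true; false; T; T?; not; _∧_; _∨_; if_then_else_)
open import Data.Bool.ListAction using (all; any)
open import Data.Bool.Properties using (T-≡; T-∧; T-∨; ∨-comm)
open import Data.Empty using (⊥-elim)
open import Data.Sum using (inj₁; inj₂)
open import Data.Fin using (Fin; zero; suc; toℕ; fromℕ<; punchOut; combine)
import Data.Fin.Properties as FinP
open import Data.Fin.Permutation using (Permutation′; _⟨$⟩ʳ_; _⟨$⟩ˡ_; inverseˡ; inverseʳ; flip; _∘ₚ_)
  renaming (id to idₚ; transpose to transposeₚ)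
import Data.Integer as ℤ
import Data.Integer.Properties as ℤP
open import Data.List using (List; []; _∷_; map; concatMap; foldr; length; allFin; _++_; cartesianProductWith)
open import Data.List.Membership.Propositional using (_∈_)
open import Data.List.Membership.Propositional.Properties using (∈-allFin; ∈-map⁺; ∈-cartesianProductWith⁺)
open import Data.List.Membership.Propositional.Properties.WithK using (unique∧set⇒bag)
open import Data.List.Properties using (map-cong; map-∘; length-tabulate; length-filter; filter-≐; filter-some; filter-none)
open import Data.List.Relation.Binary.BagAndSetEquality using (∼bag⇒↭)
open import Data.List.Relation.Binary.Permutation.Propositional using (_↭_)
open import Data.List.Relation.Binary.Permutation.Propositional.Properties using (↭-length; filter-↭)
open import Data.List.Relation.Unary.All as All using (All; []; _∷_)
import Data.List.Relation.Unary.All.Properties as AllP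
open import Data.List.Relation.Unary.AllPairs using ([]; _∷_)
open import Data.List.Relation.Unary.Any as Any using (here; there)
open import Data.List.Relation.Unary.Unique.Propositional using (Unique)
import Data.List.Relation.Unary.Unique.Propositional.Properties as UniqueP
open import Data.Nat using (ℕ; zero; suc; _+_; _*_; _^_; _≤_; _<_; _<ᵇ_; z≤n; s≤s)
open import Data.Nat.ListAction using (sum)
import Data.Nat.Properties as ℕP
open import Algebra.Properties.CommutativeSemigroup ℕP.+-commutativeSemigroup using (interchange)
open import Data.Product using (Σ; ∃; ∃-syntax; _×_; _,_; proj₁; proj₂)
open import Data.Rational as ℚ using (ℚ; 1ℚ; ½)
import Data.Rational.Properties as ℚP
open import Data.Rational.Solver using (module +-*-Solver)
open import Data.Rational.Unnormalised using (mkℚᵘ; *≡*)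
open import Data.Unit using (tt)
open import Data.Vec as Vec using (Vec; []; _∷_; lookup; tabulate)
import Data.Vec.Properties as VecP
open import Function using (_∘_; Equivalence; mk⇔)
open import Relation.Binary.Definitions using (tri<; tri≈; tri>)
open import Relation.Binary.PropositionalEquality
open import Relation.Nullary using (¬_; Dec; yes; no)
open import Relation.Nullary.Decidable using (toWitness; fromWitness; dec-true; dec-false)

open Equivalence using (to; from)

private
  variable
    A B I : Set
    N : ℕ

T-ext : ∀ {a b} → (T a → T b) → (T b → T a) → a ≡ b
T-ext {false} {false} _ _ = refl
T-ext {false} {true} _ b⇒a = ⊥-elim (b⇒a tt)
T-ext {true} {false} a⇒b _ = ⊥-elim (a⇒b tt)
T-ext {true} {true} _ _ = refl

T-not : ∀ {b} → T (not b) → ¬ T b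
T-not {false} _ ()

all-sound : ∀ (p : A → Bool) xs → T (all p xs) → ∀ {x} → x ∈ xs → T (p x)
all-sound p (y ∷ xs) all-p (here refl) = proj₁ (to T-∧ all-p)
all-sound p (y ∷ xs) all-p (there x∈xs) = all-sound p xs (proj₂ (to T-∧ all-p)) x∈xs

all-complete : ∀ (p : A → Bool) xs → (∀ x → T (p x)) → T (all p xs)
all-complete p [] every = tt
all-complete p (x ∷ xs) every = from T-∧ (every x , all-complete p xs every)

any-sound : ∀ (p : A → Bool) xs → T (any p xs) → ∃ λ x → T (p x)
any-sound p (x ∷ xs) any-p with to T-∨ any-p
... | inj₁ px = x , px
... | inj₂ any-p′ = any-sound p xs any-p′

any-complete : ∀ (p : A → Bool) {x} xs → x ∈ xs → T (p x) → T (any p xs)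
any-complete p (y ∷ xs) (here refl) px = from T-∨ (inj₁ px)
any-complete p (y ∷ xs) (there x∈xs) px = from T-∨ (inj₂ (any-complete p xs x∈xs px))

==F-sound : ∀ {m} {a b : Fin m} → T (a ==F b) → a ≡ b
==F-sound = toWitness

==F-complete : ∀ {m} {a b : Fin m} → a ≡ b → T (a ==F b)
==F-complete = fromWitness

<ᵇ-irrefl : ∀ m → ¬ T (m <ᵇ m)
<ᵇ-irrefl m m<m = ℕP.<-irrefl refl (ℕP.<ᵇ⇒< m m m<m)

<ᵇ-true : ∀ {m n} → m < n → (m <ᵇ n) ≡ true
<ᵇ-true m<n = to T-≡ (ℕP.<⇒<ᵇ m<n)

<ᵇ-true⁻ : ∀ m n → (m <ᵇ n) ≡ true → m < n
<ᵇ-true⁻ m n m<n = ℕP.<ᵇ⇒< m n (from T-≡ m<n)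

<ᵇ-false⁻ : ∀ m n → (m <ᵇ n) ≡ false → ¬ m < n
<ᵇ-false⁻ m n m≮n m<n with () ← trans (sym (<ᵇ-true m<n)) m≮n

<ᵇ-false : ∀ {m n} → ¬ m < n → (m <ᵇ n) ≡ false
<ᵇ-false {m} {n} m≮n with m <ᵇ n in eq
... | false = refl
... | true = ⊥-elim (m≮n (<ᵇ-true⁻ m n eq))

<ᵇ-flip : ∀ {m n} → m ≢ n → (n <ᵇ m) ≡ not (m <ᵇ n)
<ᵇ-flip {m} {n} m≢n with ℕP.<-cmp m n
... | tri< m<n _ n≮m rewrite <ᵇ-true m<n | <ᵇ-false n≮m = refl
... | tri≈ _ m≡n _ = ⊥-elim (m≢n m≡n)
... | tri> m≮n _ n<m rewrite <ᵇ-true n<m | <ᵇ-false m≮n = refl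

ind : Bool → ℕ
ind true = 1
ind false = 0

ind-T : ∀ {b} → T b → ind b ≡ 1
ind-T {true} _ = refl

ind-¬T : ∀ {b} → ¬ T b → ind b ≡ 0
ind-¬T {true} ¬b = ⊥-elim (¬b tt)
ind-¬T {false} _ = refl

ind-mono : ∀ {a b} → (T a → T b) → ind a ≤ ind b
ind-mono {false} _ = z≤n
ind-mono {true} a⇒b rewrite ind-T (a⇒b tt) = ℕP.≤-refl

count-∷ : ∀ (p : A → Bool) x xs → count p (x ∷ xs) ≡ ind (p x) + count p xs
count-∷ p x xs with p x
... | true = refl
... | false = refl

count-cong : ∀ {p q : A → Bool} → (∀ x → p x ≡ q x) → ∀ xs → count p xs ≡ count q xs
count-cong {p = p} {q = q} p≗q xs =
  cong length (filter-≐ (T? ∘ p) (T? ∘ q) ((λ {x} → subst T (p≗q x)) , (λ {x} → subst T (sym (p≗q x)))) xs)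

count-↭ : ∀ (p : A → Bool) {xs ys} → xs ↭ ys → count p xs ≡ count p ys
count-↭ p xs↭ys = ↭-length (filter-↭ (T? ∘ p) xs↭ys)

count-map : ∀ (p : B → Bool) (f : A → B) xs → count p (map f xs) ≡ count (p ∘ f) xs
count-map p f [] = refl
count-map p f (x ∷ xs) rewrite count-∷ p (f x) (map f xs) | count-∷ (p ∘ f) x xs | count-map p f xs = refl

count-∘-bijection : ∀ (p : A → Bool) xs → Unique xs → (∀ x → x ∈ xs) →
  (f g : A → A) → (∀ x → f (g x) ≡ x) → (∀ x → g (f x) ≡ x) →
  count (p ∘ f) xs ≡ count p xs
count-∘-bijection p xs unique complete f g fg gf =
  trans (sym (count-map p f xs)) (count-↭ p fxs↭xs)
  where
  f-injective : ∀ {x y} → f x ≡ f y → x ≡ y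
  f-injective {x} {y} fx≡fy = trans (sym (gf x)) (trans (cong g fx≡fy) (gf y))
  fxs↭xs : map f xs ↭ xs
  fxs↭xs = ∼bag⇒↭ (unique∧set⇒bag (UniqueP.map⁺ f-injective unique) unique
    (λ {x} → mk⇔ (λ _ → complete x) (λ _ → subst (_∈ map f xs) (fg x) (∈-map⁺ f (complete (g x))))))

count-mono : ∀ (p q : A → Bool) → (∀ x → T (p x) → T (q x)) → ∀ xs → count p xs ≤ count q xs
count-mono p q p⇒q [] = z≤n
count-mono p q p⇒q (x ∷ xs) rewrite count-∷ p x xs | count-∷ q x xs =
  ℕP.+-mono-≤ (ind-mono (p⇒q x)) (count-mono p q p⇒q xs)

count-strict : ∀ (p q : A → Bool) → (∀ x → T (p x) → T (q x)) →
  ∀ {y xs} → y ∈ xs → ¬ T (p y) → T (q y) → count p xs < count q xs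
count-strict p q p⇒q {xs = x ∷ xs} (here refl) ¬py qy
  rewrite count-∷ p x xs | count-∷ q x xs | ind-¬T ¬py | ind-T qy = s≤s (count-mono p q p⇒q xs)
count-strict p q p⇒q {xs = x ∷ xs} (there y∈xs) ¬py qy
  rewrite count-∷ p x xs | count-∷ q x xs =
  ℕP.+-mono-≤-< (ind-mono (p⇒q x)) (count-strict p q p⇒q y∈xs ¬py qy)

count-positive : ∀ (p : A → Bool) {y xs} → y ∈ xs → T (p y) → 0 < count p xs
count-positive p y∈xs py = filter-some (T? ∘ p) (Any.map (λ { refl → py }) y∈xs)

count-none : ∀ (p : A → Bool) {xs} → All (λ x → ¬ T (p x)) xs → count p xs ≡ 0
count-none p none = cong length (filter-none (T? ∘ p) none)

count-singleton : ∀ (p : A → Bool) {x xs} → Unique xs → x ∈ xs →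
  T (p x) → (∀ y → T (p y) → y ≡ x) → count p xs ≡ 1
count-singleton p {xs = y ∷ ys} (y∉ys ∷ _) (here refl) px only
  rewrite count-∷ p y ys | ind-T px =
  cong suc (count-none p (All.map (λ y≢z pz → y≢z (sym (only _ pz))) y∉ys))
count-singleton p {xs = y ∷ ys} (y∉ys ∷ unique) (there x∈ys) px only
  rewrite count-∷ p y ys | ind-¬T (λ py → All.lookup y∉ys x∈ys (only y py)) =
  count-singleton p unique x∈ys px only

sum-map-+ : ∀ (f g : I → ℕ) is → sum (map (λ i → f i + g i) is) ≡ sum (map f is) + sum (map g is)
sum-map-+ f g [] = refl
sum-map-+ f g (i ∷ is) = trans (cong (f i + g i +_) (sum-map-+ f g is)) (interchange (f i) (g i) _ _)

sum-map-constant : ∀ (f : I → ℕ) {c} → (∀ i → f i ≡ c) → ∀ is → sum (map f is) ≡ length is * c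
sum-map-constant f f≡c [] = refl
sum-map-constant f f≡c (i ∷ is) = cong₂ _+_ (f≡c i) (sum-map-constant f f≡c is)

count-Σ : ∀ (p : A → Bool) (q : I → A → Bool) is →
  (∀ x → ind (p x) ≡ sum (map (λ i → ind (q i x)) is)) →
  ∀ xs → count p xs ≡ sum (map (λ i → count (q i) xs) is)
count-Σ p q is split [] = sym (trans (sum-map-constant (λ _ → 0) (λ _ → refl) is) (ℕP.*-zeroʳ (length is)))
count-Σ p q is split (x ∷ xs) = begin
  count p (x ∷ xs)                                     ≡⟨ count-∷ p x xs ⟩
  ind (p x) + count p xs                               ≡⟨ cong₂ _+_ (split x) (count-Σ p q is split xs) ⟩
  sum (map (λ i → ind (q i x)) is) + sum (map (λ i → count (q i) xs) is)
                                                       ≡⟨ sum-map-+ _ _ is ⟨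
  sum (map (λ i → ind (q i x) + count (q i) xs) is)    ≡⟨ cong sum (map-cong (λ i → count-∷ (q i) x xs) is) ⟨
  sum (map (λ i → count (q i) (x ∷ xs)) is)            ∎
  where open ≡-Reasoning

allVecs-cartesian : ∀ (xs : List A) k → allVecs xs (suc k) ≡ cartesianProductWith _∷_ xs (allVecs xs k)
allVecs-cartesian [] k = refl
allVecs-cartesian (x ∷ xs) k = cong (map (x ∷_) (allVecs (x ∷ xs) k) ++_) (rest xs)
  where
  rest : ∀ ys → concatMap (λ y → map (y ∷_) (allVecs (x ∷ xs) k)) ys ≡ cartesianProductWith _∷_ ys (allVecs (x ∷ xs) k)
  rest [] = refl
  rest (y ∷ ys) = cong (map (y ∷_) (allVecs (x ∷ xs) k) ++_) (rest ys)

allVecs-unique : ∀ {xs : List A} → Unique xs → ∀ k → Unique (allVecs xs k)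
allVecs-unique unique zero = [] ∷ []
allVecs-unique {xs = xs} unique (suc k) rewrite allVecs-cartesian xs k =
  UniqueP.cartesianProductWith⁺ _∷_ VecP.∷-injective unique (allVecs-unique unique k)

allVecs-complete : ∀ {xs : List A} → (∀ x → x ∈ xs) → ∀ {k} (v : Vec A k) → v ∈ allVecs xs k
allVecs-complete complete [] = here refl
allVecs-complete {xs = xs} complete {suc k} (x ∷ v) rewrite allVecs-cartesian xs k =
  ∈-cartesianProductWith⁺ _∷_ (complete x) (allVecs-complete complete v)

pos : ∀ {n} → Ordering n → Fin n → ℕ
pos α v = toℕ (lookup α v)

orderings : ∀ n → List (Ordering n)
orderings n = allVecs (allFin n) n

record Compatible {n} (φ : Assign n) (α : Ordering n) : Set where
  field
    injective  : ∀ {u v} → lookup α u ≡ lookup α v → u ≡ v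
    surjective : ∀ x → ∃ λ v → lookup α v ≡ x
    lower      : ∀ v → lo φ (lookup φ v) ≤ pos α v
    upper      : ∀ v → pos α v < hi φ (lookup φ v)
open Compatible public

module _ {n} (φ : Assign n) (α : Ordering n) where

  one-one-sound : ∀ {u v} → T (not (lookup α u ==F lookup α v) ∨ (u ==F v)) → lookup α u ≡ lookup α v → u ≡ v
  one-one-sound clause αu≡αv with to T-∨ clause
  ... | inj₁ αu≢αv = ⊥-elim (T-not αu≢αv (==F-complete αu≡αv))
  ... | inj₂ u≡v = ==F-sound u≡v

  one-one-complete : ∀ {u v} → (lookup α u ≡ lookup α v → u ≡ v) → T (not (lookup α u ==F lookup α v) ∨ (u ==F v))
  one-one-complete {u} {v} inj with lookup α u ==F lookup α v in eq
  ... | false = tt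
  ... | true = from T-∨ (inj₂ (==F-complete (inj (==F-sound (subst T (sym eq) tt)))))

  compatible-sound : T (compatible φ α) → Compatible φ α
  compatible-sound ok with to T-∧ ok
  ... | bijective , bounded with to T-∧ bijective
  ...   | one-one , onto = record
    { injective  = λ {u} {v} → one-one-sound (all-sound _ (allFin n) (all-sound _ (allFin n) one-one (∈-allFin u)) (∈-allFin v))
    ; surjective = λ x → let v , αv≡x = any-sound _ (allFin n) (all-sound _ (allFin n) onto (∈-allFin x))
                         in v , ==F-sound αv≡x
    ; lower      = λ v → ℕP.≤ᵇ⇒≤ _ _ (proj₁ (to T-∧ (all-sound _ (allFin n) bounded (∈-allFin v))))
    ; upper      = λ v → ℕP.<ᵇ⇒< _ _ (proj₂ (to T-∧ (all-sound _ (allFin n) bounded (∈-allFin v)))) }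

  compatible-complete : Compatible φ α → T (compatible φ α)
  compatible-complete c = from T-∧
    ( from T-∧ ( all-complete _ (allFin n) (λ u → all-complete _ (allFin n) (λ v → one-one-complete (injective c)))
               , all-complete _ (allFin n) onto )
    , all-complete _ (allFin n) (λ v → from T-∧ (ℕP.≤⇒≤ᵇ (lower c v) , ℕP.<⇒<ᵇ (upper c v))) )
    where
    onto : ∀ x → T (any (λ v → lookup α v ==F x) (allFin n))
    onto x = let v , αv≡x = surjective c x in any-complete _ (allFin n) (∈-allFin v) (==F-complete αv≡x)

module Blocks {n} (φ : Assign n) where

  hi≤lo : ∀ {a b : Fin 4} → toℕ a < toℕ b → hi φ a ≤ lo φ b
  hi≤lo {a} {b} a<b = count-mono _ _ below (allFin n)
    where
    below : ∀ u → T ((lookup φ u <F a) ∨ (lookup φ u ==F a)) → T (lookup φ u <F b)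
    below u u≤a with to T-∨ u≤a
    ... | inj₁ u<a = ℕP.<⇒<ᵇ (ℕP.<-trans (ℕP.<ᵇ⇒< _ _ u<a) a<b)
    ... | inj₂ u≡a rewrite ==F-sound u≡a = ℕP.<⇒<ᵇ a<b

  block-order : ∀ {α} → Compatible φ α → ∀ {u v} →
    toℕ (lookup φ u) < toℕ (lookup φ v) → pos α u < pos α v
  block-order c {u} {v} φu<φv = ℕP.<-≤-trans (upper c u) (ℕP.≤-trans (hi≤lo φu<φv) (lower c v))

  block-order⁻ : ∀ {α} → Compatible φ α → ∀ {u v} → lookup φ u ≢ lookup φ v →
    pos α u < pos α v → toℕ (lookup φ u) < toℕ (lookup φ v)
  block-order⁻ c φu≢φv u<v =
    FinP.≤∧≢⇒< (ℕP.≮⇒≥ (λ φv<φu → ℕP.<-asym u<v (block-order c φv<φu))) φu≢φv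

  block-order-ᵇ : ∀ {α} → Compatible φ α → ∀ {u v} → lookup φ u ≢ lookup φ v →
    (pos α u <ᵇ pos α v) ≡ (toℕ (lookup φ u) <ᵇ toℕ (lookup φ v))
  block-order-ᵇ c φu≢φv = T-ext
    (ℕP.<⇒<ᵇ ∘ block-order⁻ c φu≢φv ∘ ℕP.<ᵇ⇒< _ _)
    (ℕP.<⇒<ᵇ ∘ block-order c ∘ ℕP.<ᵇ⇒< _ _)

injective⇒surjective : ∀ {n} (f : Fin n → Fin n) → (∀ {u v} → f u ≡ f v → u ≡ v) →
  ∀ x → ∃ λ v → f v ≡ x
injective⇒surjective {suc m} f f-injective x with FinP.any? (λ v → f v FinP.≟ x)
... | yes hit = hit
... | no miss with FinP.pigeonhole (ℕP.n<1+n m) squeeze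
  where
  squeeze : Fin (suc m) → Fin m
  squeeze v = punchOut {i = x} {j = f v} (λ x≡fv → miss (v , sym x≡fv))
...   | u , v , u<v , collide = ⊥-elim (FinP.<-irrefl (f-injective fu≡fv) u<v)
  where
  fu≡fv : f u ≡ f v
  fu≡fv = FinP.punchOut-injective (λ x≡fu → miss (u , sym x≡fu)) (λ x≡fv → miss (v , sym x≡fv)) collide

-- Every φ admits a compatible ordering: sort the variables by the key
-- (φ v , v) lexicographically, i.e. place v at the number of variables
-- with a smaller key.
module Sorting {n} (φ : Assign n) where

  key : Fin n → Fin (4 * n)
  key v = combine (lookup φ v) v

  precedes : Fin n → Fin n → Bool
  precedes v u = key u <F key v

  rank : Fin n → ℕ
  rank v = count (precedes v) (allFin n)

  key-block : ∀ {u v} → toℕ (lookup φ u) < toℕ (lookup φ v) → toℕ (key u) < toℕ (key v)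
  key-block {u} {v} = FinP.combine-monoˡ-< {i = lookup φ u} {j = lookup φ v} u v

  rank-mono : ∀ {u v} → toℕ (key u) < toℕ (key v) → rank u < rank v
  rank-mono {u} {v} u<v = count-strict (precedes u) (precedes v)
    (λ w w<u → ℕP.<⇒<ᵇ (ℕP.<-trans (ℕP.<ᵇ⇒< (toℕ (key w)) _ w<u) u<v))
    (∈-allFin u) (<ᵇ-irrefl (toℕ (key u))) (ℕP.<⇒<ᵇ u<v)

  rank-injective : ∀ {u v} → rank u ≡ rank v → u ≡ v
  rank-injective {u} {v} ru≡rv with FinP.<-cmp (key u) (key v)
  ... | tri< u<v _ _ = ⊥-elim (ℕP.<-irrefl ru≡rv (rank-mono u<v))
  ... | tri≈ _ u≡v _ = FinP.combine-injectiveʳ (lookup φ u) u (lookup φ v) v u≡v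
  ... | tri> _ _ v<u = ⊥-elim (ℕP.<-irrefl (sym ru≡rv) (rank-mono v<u))

  rank-lower : ∀ v → lo φ (lookup φ v) ≤ rank v
  rank-lower v = count-mono (λ u → lookup φ u <F lookup φ v) (precedes v)
    (λ u u<v → ℕP.<⇒<ᵇ (key-block (ℕP.<ᵇ⇒< (toℕ (lookup φ u)) _ u<v))) (allFin n)

  rank-upper : ∀ v → rank v < hi φ (lookup φ v)
  rank-upper v = count-strict (precedes v) _ same-or-lower-block (∈-allFin v)
    (<ᵇ-irrefl (toℕ (key v))) (from (T-∨ {lookup φ v <F lookup φ v}) (inj₂ (==F-complete refl)))
    where
    same-or-lower-block : ∀ u → T (key u <F key v) →
      T ((lookup φ u <F lookup φ v) ∨ (lookup φ u ==F lookup φ v))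
    same-or-lower-block u u<v with FinP.<-cmp (lookup φ u) (lookup φ v)
    ... | tri< φu<φv _ _ = from T-∨ (inj₁ (ℕP.<⇒<ᵇ φu<φv))
    ... | tri≈ _ φu≡φv _ = from T-∨ (inj₂ (==F-complete φu≡φv))
    ... | tri> _ _ φv<φu = ⊥-elim (ℕP.<-asym (ℕP.<ᵇ⇒< (toℕ (key u)) _ u<v) (key-block φv<φu))

  hi≤n : ∀ a → hi φ a ≤ n
  hi≤n a = subst (hi φ a ≤_) (length-tabulate (λ v → v)) (length-filter (T? ∘ (λ u → (lookup φ u <F a) ∨ (lookup φ u ==F a))) (allFin n))

  sorted : Ordering n
  sorted = tabulate (λ v → fromℕ< (ℕP.<-≤-trans (rank-upper v) (hi≤n (lookup φ v))))

  pos-sorted : ∀ v → pos sorted v ≡ rank v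
  pos-sorted v = trans (cong toℕ (VecP.lookup∘tabulate _ v)) (FinP.toℕ-fromℕ< _)

  sorted-injective : ∀ {u v} → lookup sorted u ≡ lookup sorted v → u ≡ v
  sorted-injective {u} {v} eq = rank-injective (trans (sym (pos-sorted u)) (trans (cong toℕ eq) (pos-sorted v)))

  sorted-compatible : Compatible φ sorted
  sorted-compatible = record
    { injective  = sorted-injective
    ; surjective = injective⇒surjective (lookup sorted) sorted-injective
    ; lower      = λ v → subst (lo φ (lookup φ v) ≤_) (sym (pos-sorted v)) (rank-lower v)
    ; upper      = λ v → subst (_< hi φ (lookup φ v)) (sym (pos-sorted v)) (rank-upper v) }

compatible-count-positive : ∀ {n} (φ : Assign n) → 0 < count (compatible φ) (orderings n)
compatible-count-positive φ = count-positive (compatible φ) (allVecs-complete ∈-allFin sorted)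
  (compatible-complete φ sorted sorted-compatible)
  where open Sorting φ

between : ℕ → ℕ → ℕ → Bool
between x y z = ((y <ᵇ x) ∧ (x <ᵇ z)) ∨ ((z <ᵇ x) ∧ (x <ᵇ y))

between-comm : ∀ x y z → between x y z ≡ between x z y
between-comm x y z = ∨-comm ((y <ᵇ x) ∧ (x <ᵇ z)) _

ExactlyOne : List Bool → Set
ExactlyOne bs = sum (map ind bs) ≡ 1

between-swap : ∀ {x y z} → x ≢ y → x ≢ z → y ≢ z → (x <ᵇ z) ≡ (y <ᵇ z) →
  ExactlyOne (between x y z ∷ between y x z ∷ [])
between-swap {x} {y} {z} x≢y x≢z y≢z same-side
  rewrite <ᵇ-flip x≢y | <ᵇ-flip x≢z | <ᵇ-flip y≢z | same-side
  with x <ᵇ y | y <ᵇ z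
... | true  | true  = refl
... | true  | false = refl
... | false | true  = refl
... | false | false = refl

between-swap-ends : ∀ {x y z} → x ≢ y → x ≢ z → y ≢ z → (x <ᵇ y) ≡ (z <ᵇ y) →
  ExactlyOne (between x y z ∷ between z y x ∷ [])
between-swap-ends {x} {y} {z} x≢y x≢z y≢z same-side
  rewrite between-comm x y z | between-comm z y x =
  between-swap x≢z (x≢y) (y≢z ∘ sym) same-side

between-cycle : ∀ {x y z} → x ≢ y → x ≢ z → y ≢ z →
  ExactlyOne (between x y z ∷ between y z x ∷ between z x y ∷ [])
between-cycle {x} {y} {z} x≢y x≢z y≢z
  rewrite <ᵇ-flip x≢y | <ᵇ-flip x≢z | <ᵇ-flip y≢z
  with x <ᵇ y in x<y | y <ᵇ z in y<z | x <ᵇ z in x<z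
... | true  | true  | true  = refl
... | true  | true  | false = ⊥-elim (<ᵇ-false⁻ x z x<z (ℕP.<-trans (<ᵇ-true⁻ x y x<y) (<ᵇ-true⁻ y z y<z)))
... | true  | false | true  = refl
... | true  | false | false = refl
... | false | true  | true  = refl
... | false | true  | false = refl
... | false | false | true  = ⊥-elim (<ᵇ-false⁻ y z y<z (ℕP.<-trans y<x (<ᵇ-true⁻ x z x<z)))
  where
  y<x : y < x
  y<x = ℕP.≤∧≢⇒< (ℕP.≮⇒≥ (<ᵇ-false⁻ x y x<y)) (x≢y ∘ sym)
... | false | false | false = refl

module _ {n} (i j : Fin n) where

  transpose-left : transposeₚ i j ⟨$⟩ʳ i ≡ j
  transpose-left rewrite dec-true (i FinP.≟ i) refl = refl

  transpose-right : transposeₚ i j ⟨$⟩ʳ j ≡ i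
  transpose-right with j FinP.≟ i
  ... | yes j≡i = j≡i
  ... | no _ rewrite dec-true (j FinP.≟ j) refl = refl

  transpose-other : ∀ {k} → k ≢ i → k ≢ j → transposeₚ i j ⟨$⟩ʳ k ≡ k
  transpose-other {k} k≢i k≢j rewrite dec-false (k FinP.≟ i) k≢i | dec-false (k FinP.≟ j) k≢j = refl

record Symmetry {n} (φ : Assign n) : Set where
  field
    perm      : Permutation′ n
    preserves : ∀ v → lookup φ (perm ⟨$⟩ʳ v) ≡ lookup φ v
open Symmetry public

module _ {n} {φ : Assign n} where

  identity : Symmetry φ
  identity = record { perm = idₚ ; preserves = λ _ → refl }

  transposition : ∀ i j → lookup φ i ≡ lookup φ j → Symmetry φ
  transposition i j φi≡φj = record { perm = transposeₚ i j ; preserves = preserves′ }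
    where
    preserves′ : ∀ v → lookup φ (transposeₚ i j ⟨$⟩ʳ v) ≡ lookup φ v
    preserves′ v with v FinP.≟ i
    ... | yes refl = sym φi≡φj
    ... | no _ with v FinP.≟ j
    ...   | yes refl = φi≡φj
    ...   | no _ = refl

  -- first σ, then τ
  _then_ : Symmetry φ → Symmetry φ → Symmetry φ
  σ then τ = record
    { perm = perm σ ∘ₚ perm τ
    ; preserves = λ v → trans (preserves τ (perm σ ⟨$⟩ʳ v)) (preserves σ v) }

  inverse : Symmetry φ → Symmetry φ
  inverse σ = record
    { perm = flip (perm σ)
    ; preserves = λ v → trans (sym (preserves σ (perm σ ⟨$⟩ˡ v))) (cong (lookup φ) (inverseʳ (perm σ))) }

act : ∀ {n} → Permutation′ n → Ordering n → Ordering n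
act π α = tabulate (λ v → lookup α (π ⟨$⟩ʳ v))

lookup-act : ∀ {n} (π : Permutation′ n) α v → lookup (act π α) v ≡ lookup α (π ⟨$⟩ʳ v)
lookup-act π α v = VecP.lookup∘tabulate _ v

module _ {n} (π : Permutation′ n) where

  act-flip : ∀ α → act (flip π) (act π α) ≡ α
  act-flip α = trans (VecP.tabulate-cong (λ v → trans (lookup-act π α _) (cong (lookup α) (inverseʳ π))))
                     (VecP.tabulate∘lookup α)

  flip-act : ∀ α → act π (act (flip π) α) ≡ α
  flip-act α = trans (VecP.tabulate-cong (λ v → trans (lookup-act (flip π) α _) (cong (lookup α) (inverseˡ π))))
                     (VecP.tabulate∘lookup α)

count-act : ∀ {n} (π : Permutation′ n) (p : Ordering n → Bool) →
  count (p ∘ act π) (orderings n) ≡ count p (orderings n)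
count-act {n} π p = count-∘-bijection p (orderings n) (allVecs-unique (UniqueP.allFin⁺ n) n)
  (allVecs-complete ∈-allFin) (act π) (act (flip π)) (flip-act π) (act-flip π)

satisfies-act : ∀ {n} (π : Permutation′ n) α (c : Constraint n) →
  satisfies (act π α) c ≡ between (pos α (π ⟨$⟩ʳ vi c)) (pos α (π ⟨$⟩ʳ vj c)) (pos α (π ⟨$⟩ʳ vk c))
satisfies-act π α c rewrite lookup-act π α (vi c) | lookup-act π α (vj c) | lookup-act π α (vk c) = refl

module _ {n} {φ : Assign n} (σ : Symmetry φ) where

  private
    π : Permutation′ n
    π = perm σ

  compatible-act : ∀ {α} → Compatible φ α → Compatible φ (act π α)
  compatible-act {α} c = record
    { injective  = λ {u} {v} eq → π-injective (injective c (trans (sym (lookup-act π α u)) (trans eq (lookup-act π α v))))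
    ; surjective = λ x → let w , αw≡x = surjective c x in
                   π ⟨$⟩ˡ w , trans (lookup-act π α _) (trans (cong (lookup α) (inverseʳ π)) αw≡x)
    ; lower      = λ v → subst₂ (λ a p → lo φ a ≤ toℕ p) (preserves σ v) (sym (lookup-act π α v)) (lower c (π ⟨$⟩ʳ v))
    ; upper      = λ v → subst₂ (λ a p → toℕ p < hi φ a) (preserves σ v) (sym (lookup-act π α v)) (upper c (π ⟨$⟩ʳ v)) }
    where
    π-injective : ∀ {u v} → π ⟨$⟩ʳ u ≡ π ⟨$⟩ʳ v → u ≡ v
    π-injective {u} {v} eq = trans (sym (inverseˡ π)) (trans (cong (π ⟨$⟩ˡ_) eq) (inverseˡ π))

compatible-act-ᵇ : ∀ {n} {φ : Assign n} (σ : Symmetry φ) α → compatible φ (act (perm σ) α) ≡ compatible φ α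
compatible-act-ᵇ {φ = φ} σ α = T-ext
  (λ ok → subst (T ∘ compatible φ) (act-flip (perm σ) α)
            (compatible-complete φ _ (compatible-act (inverse σ) (compatible-sound φ (act (perm σ) α) ok))))
  (λ ok → compatible-complete φ _ (compatible-act σ (compatible-sound φ α ok)))

ratio-cross : ∀ s t a b → 0 < t → s * suc b ≡ a * t → ratio s t ≡ ratio a (suc b)
ratio-cross s (suc t) a b _ eq = ℚP.fromℚᵘ-cong {mkℚᵘ (ℤ.+ s) t} {mkℚᵘ (ℤ.+ a) b}
  (*≡* (trans (sym (ℤP.pos-* s (suc b))) (trans (cong ℤ.+_ eq) (ℤP.pos-* a (suc t)))))

module Expectation {n} (φ : Assign n) (c : Constraint n) where

  #compatible #satisfying : ℕ
  #compatible = count (compatible φ) (orderings n)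
  #satisfying = count (λ α → compatible φ α ∧ satisfies α c) (orderings n)

  expect-constant : ∀ b → (∀ α → Compatible φ α → satisfies α c ≡ b) → expectSat c φ ≡ ratio (ind b) 1
  expect-constant true always = ratio-cross #satisfying #compatible 1 0 (compatible-count-positive φ)
    (trans (ℕP.*-identityʳ #satisfying) (trans (count-cong agree (orderings n)) (sym (ℕP.+-identityʳ #compatible))))
    where
    agree : ∀ α → (compatible φ α ∧ satisfies α c) ≡ compatible φ α
    agree α with compatible φ α in ok
    ... | true = always α (compatible-sound φ α (subst T (sym ok) _))
    ... | false = refl
  expect-constant false never = ratio-cross #satisfying #compatible 0 0 (compatible-count-positive φ)
    (trans (ℕP.*-identityʳ #satisfying) (count-none _ (All.universal fails (orderings n))))
    where
    fails : ∀ α → ¬ T (compatible φ α ∧ satisfies α c)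
    fails α ok with to T-∧ ok
    ... | compat , sat = subst T (never α (compatible-sound φ α compat)) sat

  -- Every compatible ordering is counted once among the images of the
  -- satisfying ones under the symmetries σs.
  orbit-count : (σs : List (Symmetry φ)) →
    (∀ α → Compatible φ α → ExactlyOne (map (λ σ → satisfies (act (perm σ) α) c) σs)) →
    #compatible ≡ length σs * #satisfying
  orbit-count σs exactly-one = begin
    #compatible                                                       ≡⟨ count-Σ (compatible φ) (λ σ → good ∘ act (perm σ)) σs split (orderings n) ⟩
    sum (map (λ σ → count (good ∘ act (perm σ)) (orderings n)) σs)    ≡⟨ sum-map-constant _ (λ σ → count-act (perm σ) good) σs ⟩
    length σs * #satisfying                                           ∎
    where
    open ≡-Reasoning
    good : Ordering n → Bool
    good α = compatible φ α ∧ satisfies α c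
    split : ∀ α → ind (compatible φ α) ≡ sum (map (λ σ → ind (good (act (perm σ) α))) σs)
    split α rewrite map-cong (λ σ → cong (λ b → ind (b ∧ satisfies (act (perm σ) α) c)) (compatible-act-ᵇ σ α)) σs
      with compatible φ α in ok
    ... | true = sym (trans (cong sum (map-∘ σs)) (exactly-one α (compatible-sound φ α (subst T (sym ok) _))))
    ... | false = sym (trans (sum-map-constant _ (λ _ → refl) σs) (ℕP.*-zeroʳ (length σs)))

  expect-orbit : (σs : List (Symmetry φ)) →
    (∀ α → Compatible φ α → ExactlyOne (map (λ σ → satisfies (act (perm σ) α) c) σs)) →
    expectSat c φ ≡ ratio 1 (length σs)
  expect-orbit [] exactly-one with () ← exactly-one (Sorting.sorted φ) (Sorting.sorted-compatible φ)
  expect-orbit σs@(_ ∷ σs′) exactly-one = ratio-cross #satisfying #compatible 1 (length σs′)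
    (compatible-count-positive φ)
    (trans (ℕP.*-comm #satisfying (length σs)) (sym (trans (ℕP.+-identityʳ #compatible) (orbit-count σs exactly-one))))

-- The expected value of ν_p in terms of the blocks a, b, c of v_i, v_j, v_k:
-- determined by the block order if a differs from b and c, and 1/2, 1/2, 1/3
-- when v_i shares its block with v_j, with v_k, or with both.
expectedᵈ : ∀ {a b c : Fin 4} → Dec (a ≡ b) → Dec (a ≡ c) → ℚ
expectedᵈ {a} {b} {c} (no _) (no _) = ratio (ind (between (toℕ a) (toℕ b) (toℕ c))) 1
expectedᵈ (yes _) (no _)  = ratio 1 2
expectedᵈ (no _)  (yes _) = ratio 1 2
expectedᵈ (yes _) (yes _) = ratio 1 3

expected : Fin 4 → Fin 4 → Fin 4 → ℚ
expected a b c = expectedᵈ (a FinP.≟ b) (a FinP.≟ c)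

satisfies-act-at : ∀ {n} (π : Permutation′ n) α (c : Constraint n) {i j k} →
  π ⟨$⟩ʳ vi c ≡ i → π ⟨$⟩ʳ vj c ≡ j → π ⟨$⟩ʳ vk c ≡ k →
  satisfies (act π α) c ≡ between (pos α i) (pos α j) (pos α k)
satisfies-act-at π α c refl refl refl = satisfies-act π α c

pos-injective : ∀ {n} {φ : Assign n} {α} → Compatible φ α → ∀ {u v} → u ≢ v → pos α u ≢ pos α v
pos-injective c u≢v eq = u≢v (injective c (FinP.toℕ-injective eq))

module Classification {n} (φ : Assign n) (c : Constraint n) where
  open Expectation φ c
  open Blocks φ

  private
    i j k : Fin n
    i = vi c
    j = vj c
    k = vk c
    Φ : Fin n → Fin 4
    Φ = lookup φ

  own-block : Φ i ≢ Φ j → Φ i ≢ Φ k → ∀ α → Compatible φ α →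
    satisfies α c ≡ between (toℕ (Φ i)) (toℕ (Φ j)) (toℕ (Φ k))
  own-block i≁j i≁k α compat =
    cong₂ _∨_ (cong₂ _∧_ (block-order-ᵇ compat (i≁j ∘ sym)) (block-order-ᵇ compat i≁k))
              (cong₂ _∧_ (block-order-ᵇ compat (i≁k ∘ sym)) (block-order-ᵇ compat i≁j))

  -- v_i shares its block with v_j only: exchanging v_i and v_j pairs the
  -- compatible orderings, exactly one of each pair satisfying c.
  shares-with-j : (i∼j : Φ i ≡ Φ j) → Φ i ≢ Φ k → ∀ α → Compatible φ α →
    ExactlyOne (map (λ σ → satisfies (act (perm σ) α) c) (identity ∷ transposition {φ = φ} i j i∼j ∷ []))
  shares-with-j i∼j i≁k α compat =
    subst ExactlyOne {y = satisfies (act idₚ α) c ∷ satisfies (act (transposeₚ i j) α) c ∷ []}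
      (cong₂ _∷_ (sym (satisfies-act idₚ α c)) (cong₂ _∷_ (sym swapped) refl))
      (between-swap (pos-injective compat (i≢j c)) (pos-injective compat (i≢k c)) (pos-injective compat (j≢k c))
        same-side)
    where
    swapped : satisfies (act (transposeₚ i j) α) c ≡ between (pos α j) (pos α i) (pos α k)
    swapped = satisfies-act-at (transposeₚ i j) α c (transpose-left i j) (transpose-right i j)
                (transpose-other i j (i≢k c ∘ sym) (j≢k c ∘ sym))
    same-side : (pos α i <ᵇ pos α k) ≡ (pos α j <ᵇ pos α k)
    same-side = trans (block-order-ᵇ compat i≁k)
      (trans (cong (λ a → toℕ a <ᵇ toℕ (Φ k)) i∼j) (sym (block-order-ᵇ compat (i≁k ∘ trans i∼j))))

  shares-with-k : (i∼k : Φ i ≡ Φ k) → Φ i ≢ Φ j → ∀ α → Compatible φ α →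
    ExactlyOne (map (λ σ → satisfies (act (perm σ) α) c) (identity ∷ transposition {φ = φ} i k i∼k ∷ []))
  shares-with-k i∼k i≁j α compat =
    subst ExactlyOne {y = satisfies (act idₚ α) c ∷ satisfies (act (transposeₚ i k) α) c ∷ []}
      (cong₂ _∷_ (sym (satisfies-act idₚ α c)) (cong₂ _∷_ (sym swapped) refl))
      (between-swap-ends (pos-injective compat (i≢j c)) (pos-injective compat (i≢k c)) (pos-injective compat (j≢k c))
        same-side)
    where
    swapped : satisfies (act (transposeₚ i k) α) c ≡ between (pos α k) (pos α j) (pos α i)
    swapped = satisfies-act-at (transposeₚ i k) α c (transpose-left i k)
                (transpose-other i k (i≢j c ∘ sym) (j≢k c)) (transpose-right i k)
    same-side : (pos α i <ᵇ pos α j) ≡ (pos α k <ᵇ pos α j)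
    same-side = trans (block-order-ᵇ compat i≁j)
      (trans (cong (λ a → toℕ a <ᵇ toℕ (Φ j)) i∼k) (sym (block-order-ᵇ compat (i≁j ∘ trans i∼k))))

  -- All three in one block: the cyclic shift v_i ↦ v_j ↦ v_k ↦ v_i groups the
  -- compatible orderings in threes, exactly one of each satisfying c.
  module Cycle (i∼j : Φ i ≡ Φ j) (i∼k : Φ i ≡ Φ k) where

    ρ : Symmetry φ
    ρ = transposition j k (trans (sym i∼j) i∼k) then transposition i j i∼j

    ρ-i : perm ρ ⟨$⟩ʳ i ≡ j
    ρ-i = trans (cong (transposeₚ i j ⟨$⟩ʳ_) (transpose-other j k (i≢j c) (i≢k c))) (transpose-left i j)

    ρ-j : perm ρ ⟨$⟩ʳ j ≡ k
    ρ-j = trans (cong (transposeₚ i j ⟨$⟩ʳ_) (transpose-left j k))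
                (transpose-other i j (i≢k c ∘ sym) (j≢k c ∘ sym))

    ρ-k : perm ρ ⟨$⟩ʳ k ≡ i
    ρ-k = trans (cong (transposeₚ i j ⟨$⟩ʳ_) (transpose-right j k)) (transpose-right i j)

    cycle : ∀ α → Compatible φ α →
      ExactlyOne (map (λ σ → satisfies (act (perm σ) α) c) (identity ∷ ρ ∷ (ρ then ρ) ∷ []))
    cycle α compat =
      subst ExactlyOne {y = satisfies (act idₚ α) c ∷ satisfies (act (perm ρ) α) c
                              ∷ satisfies (act (perm (ρ then ρ)) α) c ∷ []}
        (cong₂ _∷_ (sym (satisfies-act idₚ α c)) (cong₂ _∷_ (sym once) (cong₂ _∷_ (sym twice) refl)))
        (between-cycle (pos-injective compat (i≢j c)) (pos-injective compat (i≢k c)) (pos-injective compat (j≢k c)))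
      where
      once : satisfies (act (perm ρ) α) c ≡ between (pos α j) (pos α k) (pos α i)
      once = satisfies-act-at (perm ρ) α c ρ-i ρ-j ρ-k
      twice : satisfies (act (perm (ρ then ρ)) α) c ≡ between (pos α k) (pos α i) (pos α j)
      twice = satisfies-act-at (perm (ρ then ρ)) α c
        (trans (cong (perm ρ ⟨$⟩ʳ_) ρ-i) ρ-j) (trans (cong (perm ρ ⟨$⟩ʳ_) ρ-j) ρ-k) (trans (cong (perm ρ ⟨$⟩ʳ_) ρ-k) ρ-i)

  expectSat-blocks : expectSat c φ ≡ expected (Φ i) (Φ j) (Φ k)
  expectSat-blocks = by-cases (Φ i FinP.≟ Φ j) (Φ i FinP.≟ Φ k)
    where
    by-cases : (i≟j : Dec (Φ i ≡ Φ j)) (i≟k : Dec (Φ i ≡ Φ k)) → expectSat c φ ≡ expectedᵈ i≟j i≟k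
    by-cases (no i≁j)  (no i≁k)  = expect-constant _ (own-block i≁j i≁k)
    by-cases (yes i∼j) (no i≁k)  = expect-orbit (identity ∷ transposition i j i∼j ∷ []) (shares-with-j i∼j i≁k)
    by-cases (no i≁j)  (yes i∼k) = expect-orbit (identity ∷ transposition i k i∼k ∷ []) (shares-with-k i∼k i≁j)
    by-cases (yes i∼j) (yes i∼k) = expect-orbit (identity ∷ ρ ∷ (ρ then ρ) ∷ []) cycle
      where open Cycle i∼j i∼k

open +-*-Solver

monomial : Vec Bool N → List (Fin N) → ℚ
monomial σ = foldr (λ i r → sign (lookup σ i) ℚ.* r) 1ℚ

eval-++ : ∀ (P Q : Poly N) σ → evalPoly (P ++ Q) σ ≡ evalPoly P σ ℚ.+ evalPoly Q σ
eval-++ [] Q σ = sym (ℚP.+-identityˡ _)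
eval-++ ((a , m) ∷ P) Q σ rewrite eval-++ P Q σ = sym (ℚP.+-assoc (a ℚ.* monomial σ m) _ _)

scale : ℚ → Poly N → Poly N
scale a = map (λ t → a ℚ.* proj₁ t , proj₂ t)

eval-scale : ∀ a (P : Poly N) σ → evalPoly (scale a P) σ ≡ a ℚ.* evalPoly P σ
eval-scale a [] σ = sym (ℚP.*-zeroʳ a)
eval-scale a ((b , m) ∷ P) σ rewrite eval-scale a P σ =
  solve 4 (λ a b x e → a :* b :* x :+ a :* e := a :* (b :* x :+ e)) refl a b (monomial σ m) (evalPoly P σ)

times : Fin N → Poly N → Poly N
times i = map (λ t → proj₁ t , i ∷ proj₂ t)

eval-times : ∀ i (P : Poly N) σ → evalPoly (times i P) σ ≡ sign (lookup σ i) ℚ.* evalPoly P σ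
eval-times i [] σ = sym (ℚP.*-zeroʳ (sign (lookup σ i)))
eval-times i ((b , m) ∷ P) σ rewrite eval-times i P σ =
  solve 4 (λ s b x e → b :* (s :* x) :+ s :* e := s :* (b :* x :+ e)) refl (sign (lookup σ i)) b (monomial σ m) (evalPoly P σ)

-- ((1 + x_i)/2) · P + ((1 - x_i)/2) · Q: equal to P where x_i = 1 and to Q
-- where x_i = -1.
branch : Fin N → Poly N → Poly N → Poly N
branch i P Q = scale ½ (P ++ Q) ++ times i (scale ½ P ++ scale (ℚ.- ½) Q)

eval-branch : ∀ i (P Q : Poly N) σ →
  evalPoly (branch i P Q) σ ≡ (if lookup σ i then evalPoly P σ else evalPoly Q σ)
eval-branch i P Q σ
  rewrite eval-++ (scale ½ (P ++ Q)) (times i (scale ½ P ++ scale (ℚ.- ½) Q)) σ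
        | eval-scale ½ (P ++ Q) σ | eval-++ P Q σ
        | eval-times i (scale ½ P ++ scale (ℚ.- ½) Q) σ
        | eval-++ (scale ½ P) (scale (ℚ.- ½) Q) σ | eval-scale ½ P σ | eval-scale (ℚ.- ½) Q σ
  with lookup σ i
... | true  = solve 2 (λ p q → con ½ :* (p :+ q) :+ con 1ℚ :* (con ½ :* p :+ con (ℚ.- ½) :* q) := p) refl
                (evalPoly P σ) (evalPoly Q σ)
... | false = solve 2 (λ p q → con ½ :* (p :+ q) :+ con (ℚ.- 1ℚ) :* (con ½ :* p :+ con (ℚ.- ½) :* q) := q) refl
                (evalPoly P σ) (evalPoly Q σ)

degree≤-++ : ∀ {d} {P Q : Poly N} → degree≤ d P → degree≤ d Q → degree≤ d (P ++ Q)
degree≤-++ = AllP.++⁺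

degree≤-weaken : ∀ {d e} {P : Poly N} → d ≤ e → degree≤ d P → degree≤ e P
degree≤-weaken d≤e = All.map (λ m≤d → ℕP.≤-trans m≤d d≤e)

degree≤-scale : ∀ {d} a {P : Poly N} → degree≤ d P → degree≤ d (scale a P)
degree≤-scale a = AllP.map⁺

degree≤-times : ∀ {d} i {P : Poly N} → degree≤ d P → degree≤ (suc d) (times i P)
degree≤-times i = AllP.map⁺ ∘ All.map s≤s

degree≤-branch : ∀ {d} i {P Q : Poly N} → degree≤ d P → degree≤ d Q → degree≤ (suc d) (branch i P Q)
degree≤-branch {d = d} i P≤d Q≤d = degree≤-++
  (degree≤-weaken (ℕP.n≤1+n d) (degree≤-scale ½ (degree≤-++ P≤d Q≤d)))
  (degree≤-times i (degree≤-++ (degree≤-scale ½ P≤d) (degree≤-scale (ℚ.- ½) Q≤d)))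

-- Every function of k of the ±1 variables is a polynomial of degree ≤ k in
-- them: branch on the variables one at a time.
interpolate : ∀ {k} → Vec (Fin N) k → (Vec Bool k → ℚ) → Poly N
interpolate [] f = (f [] , []) ∷ []
interpolate (i ∷ is) f = branch i (interpolate is (f ∘ (true ∷_))) (interpolate is (f ∘ (false ∷_)))

eval-interpolate : ∀ {k} (is : Vec (Fin N) k) f σ → evalPoly (interpolate is f) σ ≡ f (Vec.map (lookup σ) is)
eval-interpolate [] f σ = trans (ℚP.+-identityʳ (f [] ℚ.* 1ℚ)) (ℚP.*-identityʳ (f []))
eval-interpolate (i ∷ is) f σ rewrite eval-branch i (interpolate is (f ∘ (true ∷_))) (interpolate is (f ∘ (false ∷_))) σ
  with lookup σ i
... | true  = eval-interpolate is (f ∘ (true ∷_)) σ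
... | false = eval-interpolate is (f ∘ (false ∷_)) σ

degree≤-interpolate : ∀ {k} (is : Vec (Fin N) k) f → degree≤ k (interpolate is f)
degree≤-interpolate [] f = z≤n ∷ []
degree≤-interpolate (i ∷ is) f =
  degree≤-branch i (degree≤-interpolate is (f ∘ (true ∷_))) (degree≤-interpolate is (f ∘ (false ∷_)))

encode : Bool → Bool → Fin 4
encode true  true  = zero
encode true  false = suc zero
encode false true  = suc (suc zero)
encode false false = suc (suc (suc zero))

high low : Fin 4 → Bool
high zero = true
high (suc zero) = true
high (suc (suc zero)) = false
high (suc (suc (suc zero))) = false
low zero = true
low (suc zero) = false
low (suc (suc zero)) = true
low (suc (suc (suc zero))) = false

encode-bits : ∀ a → encode (high a) (low a) ≡ a
encode-bits zero = refl
encode-bits (suc zero) = refl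
encode-bits (suc (suc zero)) = refl
encode-bits (suc (suc (suc zero))) = refl

high-encode : ∀ x y → high (encode x y) ≡ x
high-encode true  true  = refl
high-encode true  false = refl
high-encode false true  = refl
high-encode false false = refl

low-encode : ∀ x y → low (encode x y) ≡ y
low-encode true  true  = refl
low-encode true  false = refl
low-encode false true  = refl
low-encode false false = refl

double : ℕ → ℕ
double zero = zero
double (suc n) = suc (suc (double n))

assignment : ∀ n → Vec Bool (double n) → Assign n
assignment zero [] = []
assignment (suc n) (x ∷ y ∷ σ) = encode x y ∷ assignment n σ

point : ∀ {n} → Assign n → Vec Bool (double n)
point [] = []
point (a ∷ φ) = high a ∷ low a ∷ point φ

assignment-point : ∀ {n} (φ : Assign n) → assignment n (point φ) ≡ φ
assignment-point [] = refl
assignment-point (a ∷ φ) = cong₂ _∷_ (encode-bits a) (assignment-point φ)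

point-assignment : ∀ n (σ : Vec Bool (double n)) → point (assignment n σ) ≡ σ
point-assignment zero [] = refl
point-assignment (suc n) (x ∷ y ∷ σ) =
  cong₂ _∷_ (high-encode x y) (cong₂ _∷_ (low-encode x y) (point-assignment n σ))

high-bit low-bit : ∀ {n} → Fin n → Fin (double n)
high-bit {suc n} zero = zero
high-bit {suc n} (suc v) = suc (suc (high-bit v))
low-bit {suc n} zero = suc zero
low-bit {suc n} (suc v) = suc (suc (low-bit v))

lookup-assignment : ∀ n (σ : Vec Bool (double n)) v →
  lookup (assignment n σ) v ≡ encode (lookup σ (high-bit v)) (lookup σ (low-bit v))
lookup-assignment (suc n) (x ∷ y ∷ σ) zero = refl
lookup-assignment (suc n) (x ∷ y ∷ σ) (suc v) = lookup-assignment n σ v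

==V-sound : ∀ {k} (u v : Vec (Fin 4) k) → T ((_==F_ ==V u) v) → u ≡ v
==V-sound [] [] _ = refl
==V-sound (a ∷ u) (b ∷ v) eq = let a≡b , u≡v = to T-∧ eq in
  cong₂ _∷_ (==F-sound a≡b) (==V-sound u v u≡v)

==V-complete : ∀ {k} {u v : Vec (Fin 4) k} → u ≡ v → T ((_==F_ ==V u) v)
==V-complete {u = []} {[]} refl = _
==V-complete {u = a ∷ u} {b ∷ v} refl = from T-∧ (==F-complete refl , ==V-complete {u = u} refl)

-- Each assignment is hit by exactly one point, so the uniform distribution
-- on {-1,1}^(2n) is pushed to the uniform distribution on assignments.
fibre-singleton : ∀ n (φ : Assign n) →
  count (λ σ → (_==F_ ==V assignment n σ) φ) (allVecs (true ∷ false ∷ []) (double n)) ≡ 1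
fibre-singleton n φ = count-singleton _
  (allVecs-unique (((λ ()) ∷ []) ∷ [] ∷ []) (double n))
  (allVecs-complete (λ { true → here refl ; false → there (here refl) }) (point φ))
  (==V-complete (assignment-point φ))
  (λ σ hit → trans (sym (point-assignment n σ)) (cong point (==V-sound _ φ hit)))

4^n≡2^2n : ∀ n → 4 ^ n ≡ 2 ^ double n
4^n≡2^2n zero = refl
4^n≡2^2n (suc n) = trans (cong (4 *_) (4^n≡2^2n n)) (ℕP.*-assoc 2 2 (2 ^ double n))

uniform : ∀ n → uniformPush (assignment n)
uniform n φ rewrite fibre-singleton n φ = trans (ℕP.*-identityˡ (4 ^ n)) (4^n≡2^2n n)

weight : Vec Bool 6 → ℚ
weight (x ∷ x′ ∷ y ∷ y′ ∷ z ∷ z′ ∷ []) = expected (encode x x′) (encode y y′) (encode z z′) ℚ.- ℤ.+ 1 ℚ./ 3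

constraintBits : ∀ {n} → Constraint n → Vec (Fin (double n)) 6
constraintBits c = high-bit (vi c) ∷ low-bit (vi c) ∷ high-bit (vj c) ∷ low-bit (vj c) ∷ high-bit (vk c) ∷ low-bit (vk c) ∷ []

constraintPoly : ∀ {n} → Constraint n → Poly (double n)
constraintPoly c = interpolate (constraintBits c) weight

eval-constraintPoly : ∀ n (c : Constraint n) σ → evalPoly (constraintPoly c) σ ≡ wC c (assignment n σ)
eval-constraintPoly n c σ = begin
  evalPoly (constraintPoly c) σ                  ≡⟨ eval-interpolate (constraintBits c) weight σ ⟩
  weight (Vec.map (lookup σ) (constraintBits c))  ≡⟨ cong (ℚ._- ℤ.+ 1 ℚ./ 3) (sym blocks) ⟩
  expected (Φ (vi c)) (Φ (vj c)) (Φ (vk c)) ℚ.- ℤ.+ 1 ℚ./ 3 ≡⟨ cong (ℚ._- ℤ.+ 1 ℚ./ 3) (sym (Classification.expectSat-blocks φ c)) ⟩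
  wC c φ                                          ∎
  where
  open ≡-Reasoning
  φ : Assign n
  φ = assignment n σ
  Φ : Fin n → Fin 4
  Φ = lookup φ
  bits : Fin n → Fin 4
  bits v = encode (lookup σ (high-bit v)) (lookup σ (low-bit v))
  blocks : expected (Φ (vi c)) (Φ (vj c)) (Φ (vk c)) ≡ expected (bits (vi c)) (bits (vj c)) (bits (vk c))
  blocks rewrite lookup-assignment n σ (vi c) | lookup-assignment n σ (vj c) | lookup-assignment n σ (vk c) = refl

systemPoly : ∀ {n} → List (Constraint n) → Poly (double n)
systemPoly [] = []
systemPoly (c ∷ C) = constraintPoly c ++ systemPoly C

eval-systemPoly : ∀ n (C : List (Constraint n)) σ → evalPoly (systemPoly C) σ ≡ w C (assignment n σ)
eval-systemPoly n [] σ = refl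
eval-systemPoly n (c ∷ C) σ =
  trans (eval-++ (constraintPoly c) (systemPoly C) σ) (cong₂ ℚ._+_ (eval-constraintPoly n c σ) (eval-systemPoly n C σ))

degree≤-systemPoly : ∀ {n} (C : List (Constraint n)) → degree≤ 6 (systemPoly C)
degree≤-systemPoly [] = []
degree≤-systemPoly (c ∷ C) = degree≤-++ (degree≤-interpolate (constraintBits c) weight) (degree≤-systemPoly C)

lemma6 : (n : ℕ) (C : List (Constraint n)) →
  ∃[ N ] Σ (Poly N) (λ P → degree≤ 6 P ×
    Σ (Vec Bool N → Assign n) (λ g → uniformPush g ×
      ((σ : Vec Bool N) → evalPoly P σ ≡ w C (g σ))))
lemma6 n C =
  double n , systemPoly C , degree≤-systemPoly C , assignment n , uniform n , eval-systemPoly n C
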